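{- Let $G$ be an $r$-antipodal distance-regular graph with $n$ vertices and diameter $d$. Then the power graph $G^{d-1}$ is a strongly regular graph with parameters $(n,\kappa;a,c)$ where $\kappa=c=n-r$ and $a=n-2r$, and its Shannon capacity is $\Theta(G^{d-1})=r$.
   Context: A graph is distance-regular if for any two vertices $u,v$ at distance $l$, the number of vertices at distance $i$ from $u$ and $j$ from $v$ depends only on $l,i,j$. A graph of diameter $d$ is antipodal if its vertex set can be partitioned into classes such that two distinct vertices lie in the same class iff they are at distance $d$; it is $r$-antipodal if all classes have size $r$. The $k$-th power $G^k$ has the same vertex set as $G$, two distinct vertices adjacent iff their distance in $G$ is at most $k$. A strongly regular graph with parameters $(n,\kappa;a,c)$ is a $\kappa$-regular graph on $n$ vertices in which every two adjacent vertices have $a$ common neighbours and every two non-adjacent vertices have $c$ common neighbours. The Shannon capacity of a graph $H$ is $\Theta(H)=\sup_m\alpha(H^{\boxtimes m})^{1/m}$, with $\alpha$ the independence number and $H^{\boxtimes m}$ the $m$-fold strong product. -}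

module Defs where

open import Data.Nat using (ℕ; zero; suc; _+_; _*_; _^_; _≤_; _<_)
open import Data.Fin using (Fin; zero; suc)
open import Data.Fin.Properties using (_≟_)
open import Data.Bool using (Bool; true; false; _∧_; _∨_; not; if_then_else_)
open import Data.Vec using (Vec; []; _∷_)
open import Data.List using (List; length)
open import Data.List.Relation.Unary.AllPairs using (AllPairs)
open import Data.Product using (Σ; ∃; ∃-syntax; _×_)
open import Relation.Nullary using (¬_)
open import Relation.Nullary.Decidable using (⌊_⌋)
open import Relation.Binary.PropositionalEquality using (_≡_; _≢_)

BGraph : Set → Set
BGraph V = V → V → Bool

IsSimple : {V : Set} → BGraph V → Set
IsSimple {V} E = (∀ (u v : V) → E u v ≡ E v u) × (∀ (u : V) → E u u ≡ false)

eqF : {n : ℕ} → Fin n → Fin n → Bool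
eqF u v = ⌊ u ≟ v ⌋

anyF : {n : ℕ} → (Fin n → Bool) → Bool
anyF {zero} p = false
anyF {suc n} p = p zero ∨ anyF (λ i → p (suc i))

count : {n : ℕ} → (Fin n → Bool) → ℕ
count {zero} p = 0
count {suc n} p = (if p zero then 1 else 0) + count (λ i → p (suc i))

-- reach E k u v = true iff dist(u,v) ≤ k
reach : {n : ℕ} → BGraph (Fin n) → ℕ → Fin n → Fin n → Bool
reach E zero u v = eqF u v
reach E (suc k) u v = reach E k u v ∨ anyF (λ w → E u w ∧ reach E k w v)

isDist : {n : ℕ} → BGraph (Fin n) → Fin n → Fin n → ℕ → Bool
isDist E u v zero = eqF u v
isDist E u v (suc k) = reach E (suc k) u v ∧ not (reach E k u v)

HasDiameter : {n : ℕ} → BGraph (Fin n) → ℕ → Set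
HasDiameter {n} E d =
  (∀ (u v : Fin n) → reach E d u v ≡ true) × (∃[ u ] ∃[ v ] isDist E u v d ≡ true)

DistanceRegular : {n : ℕ} → BGraph (Fin n) → Set
DistanceRegular {n} E =
  Σ (ℕ → ℕ → ℕ → ℕ) λ p → ∀ (u v : Fin n) (l i j : ℕ) → isDist E u v l ≡ true →
    count (λ w → isDist E u w i ∧ isDist E v w j) ≡ p l i j

RAntipodal : {n : ℕ} → BGraph (Fin n) → ℕ → ℕ → Set
RAntipodal {n} E d r =
  Σ (Fin n → Fin n) λ cls →
    (∀ (u v : Fin n) → u ≢ v →
       ((cls u ≡ cls v → isDist E u v d ≡ true) × (isDist E u v d ≡ true → cls u ≡ cls v)))
    × (∀ (u : Fin n) → count (λ w → eqF (cls w) (cls u)) ≡ r)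

power : {n : ℕ} → BGraph (Fin n) → ℕ → BGraph (Fin n)
power E k u v = not (eqF u v) ∧ reach E k u v

StronglyRegular : {n : ℕ} → BGraph (Fin n) → ℕ → ℕ → ℕ → Set
StronglyRegular {n} H κ a c =
  (∀ (u : Fin n) → count (H u) ≡ κ)
  × (∀ (u v : Fin n) → H u v ≡ true → count (λ w → H u w ∧ H v w) ≡ a)
  × (∀ (u v : Fin n) → u ≢ v → H u v ≡ false → count (λ w → H u w ∧ H v w) ≡ c)

eqV : {n m : ℕ} → Vec (Fin n) m → Vec (Fin n) m → Bool
eqV [] [] = true
eqV (x ∷ xs) (y ∷ ys) = eqF x y ∧ eqV xs ys

closeV : {n m : ℕ} → BGraph (Fin n) → Vec (Fin n) m → Vec (Fin n) m → Bool
closeV H [] [] = true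
closeV H (x ∷ xs) (y ∷ ys) = (eqF x y ∨ H x y) ∧ closeV H xs ys

strongPow : {n : ℕ} → BGraph (Fin n) → (m : ℕ) → BGraph (Vec (Fin n) m)
strongPow H m u v = not (eqV u v) ∧ closeV H u v

Independent : {V : Set} → BGraph V → List V → Set
Independent H S = AllPairs (λ x y → (x ≢ y) × (H x y ≡ false)) S

-- Θ(H) = sup_{m ≥ 1} α(H^⊠m)^{1/m} = r, unfolded without reals:
-- (upper bound) every independent set of H^⊠m has size ≤ r^m, i.e. α(H^⊠m)^{1/m} ≤ r;
-- (least) for every rational a/b < r some m has α(H^⊠m)^{1/m} > a/b, i.e. a^m < α·b^m.
ShannonCapacityIs : {n : ℕ} → BGraph (Fin n) → ℕ → Set
ShannonCapacityIs {n} H r =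
  (∀ (m : ℕ) → 1 ≤ m → (S : List (Vec (Fin n) m)) →
     Independent (strongPow H m) S → length S ≤ r ^ m)
  × (∀ (a b : ℕ) → 1 ≤ b → a < r * b →
     Σ ℕ λ m → 1 ≤ m × Σ (List (Vec (Fin n) m)) λ S →
       Independent (strongPow H m) S × a ^ m < length S * b ^ m)

-- In an antipodal distance-regular graph of diameter d, two distinct vertices are at
-- distance d exactly when they lie in the same antipodal class, so two distinct vertices
-- are within distance d − 1 exactly when their classes differ: G^(d−1) is the complete
-- multipartite graph whose parts are the antipodal classes, each of size r. Its
-- strongly-regular parameters are then a count of vertices outside one or two parts.
-- For the capacity, one part is an independent set of size r, giving Θ ≥ r; and numbering
-- the vertices of each part by 0, …, r − 1 covers the graph by r cliques (one vertex from
-- each part), so a code of m-tuples of such numbers is injective on independent sets of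
-- the m-th strong power, giving α ≤ r^m.
module Submission where

open import Defs
open import Data.Nat using (ℕ; _∸_; _*_)
open import Data.Fin using (Fin)
open import Data.Product using (_×_)

open import Data.Bool using (Bool; true; false; _∧_; _∨_; not)
open import Data.Bool.Properties using (∧-idem; ∨-zeroʳ; not-injective)
open import Data.Fin using (zero; suc; toℕ; fromℕ<; combine)
open import Data.Fin.Properties using (_≟_; _<?_; <-cmp; <-trans; <-irrefl; pigeonhole; combine-injective; toℕ-fromℕ<)
open import Data.List using (List; []; _∷_; length; lookup; tabulate; allFin; filter; map)
open import Data.List.Properties using (length-map)
open import Data.List.Membership.Propositional.Properties using (∈-lookup)
open import Data.List.Relation.Unary.All as All using (All; []; _∷_)
open import Data.List.Relation.Unary.All.Properties using (all-filter)
open import Data.List.Relation.Unary.AllPairs as AllPairs using (AllPairs; []; _∷_)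
import Data.List.Relation.Unary.AllPairs.Properties as AllPairsₚ
import Data.List.Relation.Unary.Unique.Propositional.Properties as Uniqueₚ
open import Data.Nat using (zero; suc; _+_; _^_; _≤_; _<_; z≤n; s≤s; _≤?_)
open import Data.Nat.Properties using (+-suc; m+n∸m≡n; m≤n⇒m≤1+n; ≰⇒>; <⇒≢; +-identityʳ; *-identityʳ)
open import Data.Product using (Σ; _,_)
open import Data.Vec using (Vec; []; _∷_; [_])
open import Function using (_∘_)
open import Relation.Binary.Definitions using (tri<; tri≈; tri>)
open import Relation.Binary.PropositionalEquality hiding ([_])
open import Relation.Nullary using (Dec; yes; no; contradiction)
open import Relation.Nullary.Decidable using (isYes)

eqF-refl : ∀ {n} (u : Fin n) → eqF u u ≡ true
eqF-refl u with u ≟ u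
... | yes _ = refl
... | no u≢u = contradiction refl u≢u

eqF⇒≡ : ∀ {n} {u v : Fin n} → eqF u v ≡ true → u ≡ v
eqF⇒≡ {u = u} {v} _ with u ≟ v
eqF⇒≡ _  | yes u≡v = u≡v
eqF⇒≡ () | no _

≢⇒eqF-false : ∀ {n} {u v : Fin n} → u ≢ v → eqF u v ≡ false
≢⇒eqF-false {u = u} {v} u≢v with u ≟ v
... | yes u≡v = contradiction u≡v u≢v
... | no _ = refl

≡-not-eqF : ∀ {n} b {x y : Fin n} → (x ≡ y → not b ≡ true) → (not b ≡ true → x ≡ y) → b ≡ not (eqF x y)
≡-not-eqF b {x} {y} x≡y⇒ ⇒x≡y with x ≟ y
... | yes x≡y = not-injective (x≡y⇒ x≡y)
≡-not-eqF true  _ _   | no _   = refl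
≡-not-eqF false _ ⇒x≡y | no x≢y = contradiction (⇒x≡y refl) x≢y

eqV⇒≡ : ∀ {n m} (x y : Vec (Fin n) m) → eqV x y ≡ true → x ≡ y
eqV⇒≡ [] [] _ = refl
eqV⇒≡ (x ∷ xs) (y ∷ ys) eq with x ≟ y
eqV⇒≡ (x ∷ xs) (.x ∷ ys) eq | yes refl = cong (x ∷_) (eqV⇒≡ xs ys eq)
eqV⇒≡ (x ∷ xs) (y ∷ ys) () | no _

count-ext : ∀ {n} {p q : Fin n → Bool} → (∀ w → p w ≡ q w) → count p ≡ count q
count-ext {zero} p≗q = refl
count-ext {suc n} {p} {q} p≗q rewrite p≗q zero = cong (_ +_) (count-ext (p≗q ∘ suc))

count-complement : ∀ {n} (p : Fin n → Bool) → count p + count (not ∘ p) ≡ n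
count-complement {zero} p = refl
count-complement {suc n} p with p zero | count-complement (p ∘ suc)
... | true  | ih = cong suc ih
... | false | ih = trans (+-suc _ _) (cong suc ih)

count-not : ∀ {n} (p : Fin n → Bool) → count (not ∘ p) ≡ n ∸ count p
count-not {n} p = begin
  count (not ∘ p)                        ≡⟨ m+n∸m≡n (count p) _ ⟨
  count p + count (not ∘ p) ∸ count p    ≡⟨ cong (_∸ count p) (count-complement p) ⟩
  n ∸ count p                            ∎
  where open ≡-Reasoning

count-∨-disjoint : ∀ {n} {p q : Fin n → Bool} → (∀ w → p w ∧ q w ≡ false) →
                   count (λ w → p w ∨ q w) ≡ count p + count q
count-∨-disjoint {zero} _ = refl
count-∨-disjoint {suc n} {p} {q} disjoint
  with p zero | q zero | disjoint zero | count-∨-disjoint {p = p ∘ suc} {q ∘ suc} (disjoint ∘ suc)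
... | true  | false | _  | ih = cong suc ih
... | false | true  | _  | ih = trans (cong suc ih) (sym (+-suc _ _))
... | false | false | _  | ih = ih
... | true  | true  | () | _

count-mono : ∀ {n} {p q : Fin n → Bool} → (∀ w → p w ≡ true → q w ≡ true) → count p ≤ count q
count-mono {zero} _ = z≤n
count-mono {suc n} {p} {q} p⇒q with p zero in pz | q zero in qz
... | false | false = count-mono (p⇒q ∘ suc)
... | false | true  = m≤n⇒m≤1+n (count-mono (p⇒q ∘ suc))
... | true  | true  = s≤s (count-mono (p⇒q ∘ suc))
... | true  | false with () ← trans (sym qz) (p⇒q zero pz)

count-< : ∀ {n} {p q : Fin n → Bool} → (∀ w → p w ≡ true → q w ≡ true) →
          (x : Fin n) → p x ≡ false → q x ≡ true → count p < count q
count-< {suc n} {p} {q} p⇒q zero px qx rewrite px | qx = s≤s (count-mono (p⇒q ∘ suc))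
count-< {suc n} {p} {q} p⇒q (suc x) px qx with p zero in pz | q zero in qz
... | false | false = count-< (p⇒q ∘ suc) x px qx
... | false | true  = m≤n⇒m≤1+n (count-< (p⇒q ∘ suc) x px qx)
... | true  | true  = s≤s (count-< (p⇒q ∘ suc) x px qx)
... | true  | false with () ← trans (sym qz) (p⇒q zero pz)

count≡length-filter : ∀ {n} {A : Set} {P : A → Set} (P? : ∀ x → Dec (P x)) (f : Fin n → A) →
                      count (isYes ∘ P? ∘ f) ≡ length (filter P? (tabulate f))
count≡length-filter {zero} P? f = refl
count≡length-filter {suc n} P? f with P? (f zero)
... | yes _ = cong suc (count≡length-filter P? (f ∘ suc))
... | no _  = count≡length-filter P? (f ∘ suc)

rank : ∀ {n} → (Fin n → Bool) → Fin n → ℕ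
rank p u = count (λ w → p w ∧ isYes (w <? u))

<?-irrefl : ∀ {n} (u : Fin n) → isYes (u <? u) ≡ false
<?-irrefl u with u <? u
... | yes u<u = contradiction u<u (<-irrefl refl)
... | no _ = refl

<?-complete : ∀ {n} {w u : Fin n} → w Data.Fin.< u → isYes (w <? u) ≡ true
<?-complete {w = w} {u} w<u with w <? u
... | yes _ = refl
... | no w≮u = contradiction w<u w≮u

rank-excludes-self : ∀ {n} (p : Fin n → Bool) (u : Fin n) → p u ∧ isYes (u <? u) ≡ false
rank-excludes-self p u rewrite <?-irrefl u with p u
... | true = refl
... | false = refl

rank<count : ∀ {n} (p : Fin n → Bool) {u} → p u ≡ true → rank p u < count p
rank<count p {u} pu = count-< below⇒p u (rank-excludes-self p u) pu
  where
  below⇒p : ∀ w → p w ∧ isYes (w <? u) ≡ true → p w ≡ true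
  below⇒p w _ with p w
  ... | true = refl

rank-strictMono : ∀ {n} (p : Fin n → Bool) {x y} → p x ≡ true → x Data.Fin.< y → rank p x < rank p y
rank-strictMono p {x} {y} px x<y =
  count-< below-x⇒below-y x (rank-excludes-self p x) (cong₂ _∧_ px (<?-complete x<y))
  where
  below-x⇒below-y : ∀ w → p w ∧ isYes (w <? x) ≡ true → p w ∧ isYes (w <? y) ≡ true
  below-x⇒below-y w _ with p w | w <? x
  below-x⇒below-y w _ | true | yes w<x = <?-complete (<-trans w<x x<y)

rank-injective : ∀ {n} (p : Fin n → Bool) {x y} → p x ≡ true → p y ≡ true → rank p x ≡ rank p y → x ≡ y
rank-injective p {x} {y} px py rx≡ry with <-cmp x y
... | tri< x<y _ _ = contradiction rx≡ry (<⇒≢ (rank-strictMono p px x<y))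
... | tri≈ _ x≡y _ = x≡y
... | tri> _ _ y<x = contradiction (sym rx≡ry) (<⇒≢ (rank-strictMono p py y<x))

AllPairs-lookup : ∀ {A : Set} {R : A → A → Set} {xs : List A} → AllPairs R xs →
                  ∀ {i j} → i Data.Fin.< j → R (lookup xs i) (lookup xs j)
AllPairs-lookup (Rx ∷ _) {zero} {suc j} _ = All.lookup Rx (∈-lookup j)
AllPairs-lookup (_ ∷ Rxs) {suc i} {suc j} (s≤s i<j) = AllPairs-lookup Rxs i<j

AllPairs-restrict : ∀ {A : Set} {P : A → Set} {R Q : A → A → Set} →
                    (∀ {x y} → P x → P y → R x y → Q x y) →
                    ∀ {xs} → All P xs → AllPairs R xs → AllPairs Q xs
AllPairs-restrict f [] [] = []
AllPairs-restrict f (px ∷ pxs) (Rx ∷ Rxs) =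
  All.zipWith (λ (py , r) → f px py r) (pxs , Rx) ∷ AllPairs-restrict f pxs Rxs

distinct-images⇒length≤ : ∀ {A : Set} {k} (g : A → Fin k) {xs : List A} →
                          AllPairs (λ x y → g x ≢ g y) xs → length xs ≤ k
distinct-images⇒length≤ {k = k} g {xs} distinct with length xs ≤? k
... | yes |xs|≤k = |xs|≤k
... | no |xs|≰k with i , j , i<j , gi≡gj ← pigeonhole (≰⇒> |xs|≰k) (g ∘ lookup xs)
  = contradiction gi≡gj (AllPairs-lookup distinct i<j)

CliqueCover : ∀ {n} → BGraph (Fin n) → ℕ → Set
CliqueCover {n} H r = Σ (Fin n → Fin r) λ f → ∀ x y → f x ≡ f y → (eqF x y ∨ H x y) ≡ true

encode : ∀ {n r m} → (Fin n → Fin r) → Vec (Fin n) m → Fin (r ^ m)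
encode f [] = zero
encode f (x ∷ xs) = combine (f x) (encode f xs)

encode-≡⇒closeV : ∀ {n r m} {H : BGraph (Fin n)} ((f , _) : CliqueCover H r) (xs ys : Vec (Fin n) m) →
                  encode f xs ≡ encode f ys → closeV H xs ys ≡ true
encode-≡⇒closeV _ [] [] _ = refl
encode-≡⇒closeV cover@(f , clique) (x ∷ xs) (y ∷ ys) eq
  with fx≡fy , rest ← combine-injective (f x) (encode f xs) (f y) (encode f ys) eq
  rewrite clique x y fx≡fy = encode-≡⇒closeV cover xs ys rest

nonadjacent-closeV⇒≡ : ∀ {n m} {H : BGraph (Fin n)} (xs ys : Vec (Fin n) m) →
                       strongPow H m xs ys ≡ false → closeV H xs ys ≡ true → xs ≡ ys
nonadjacent-closeV⇒≡ xs ys nonadj close with eqV xs ys in xs≟ys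
... | true = eqV⇒≡ xs ys xs≟ys
... | false rewrite close with () ← nonadj

cliqueCover⇒independent-length≤ : ∀ {n r} {H : BGraph (Fin n)} → CliqueCover H r →
  ∀ m (S : List (Vec (Fin n) m)) → Independent (strongPow H m) S → length S ≤ r ^ m
cliqueCover⇒independent-length≤ {H = H} cover@(f , _) m S independent =
  distinct-images⇒length≤ (encode f) (AllPairs.map distinct-codes independent)
  where
  distinct-codes : ∀ {xs ys} → xs ≢ ys × strongPow H m xs ys ≡ false → encode f xs ≢ encode f ys
  distinct-codes {xs} {ys} (xs≢ys , nonadj) same-code =
    xs≢ys (nonadjacent-closeV⇒≡ xs ys nonadj (encode-≡⇒closeV cover xs ys same-code))

independent⇒singletons-independent : ∀ {n} {H : BGraph (Fin n)} {S : List (Fin n)} →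
  Independent H S → Independent (strongPow H 1) (map [_] S)
independent⇒singletons-independent {H = H} = AllPairsₚ.map⁺ ∘ AllPairs.map singleton-pair
  where
  singleton-pair : ∀ {x y} → x ≢ y × H x y ≡ false →
                   [ x ] ≢ [ y ] × strongPow H 1 [ x ] [ y ] ≡ false
  singleton-pair (x≢y , nonadj) rewrite ≢⇒eqF-false x≢y | nonadj = (λ { refl → x≢y refl }) , refl

cliqueCover-independent⇒shannonCapacity : ∀ {n r} {H : BGraph (Fin n)} → CliqueCover H r →
  (S : List (Fin n)) → Independent H S → length S ≡ r → ShannonCapacityIs H r
cliqueCover-independent⇒shannonCapacity {r = r} cover S independent |S|≡r =
  (λ m _ → cliqueCover⇒independent-length≤ cover m) ,
  λ a b _ a<rb → 1 , s≤s z≤n , map [_] S , independent⇒singletons-independent independent , bound a b a<rb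
  where
  bound : ∀ a b → a < r * b → a ^ 1 < length (map [_] S) * b ^ 1
  bound a b a<rb rewrite length-map [_] S | |S|≡r | *-identityʳ a | *-identityʳ b = a<rb

IsCompleteMultipartite : ∀ {n k} → BGraph (Fin n) → (Fin n → Fin k) → Set
IsCompleteMultipartite {n} H cls = ∀ (u v : Fin n) → H u v ≡ not (eqF (cls v) (cls u))

module CompleteMultipartite {n k r : ℕ} {H : BGraph (Fin n)} {cls : Fin n → Fin k}
  (H-parts : IsCompleteMultipartite H cls)
  (part-size : ∀ u → count (λ w → eqF (cls w) (cls u)) ≡ r) where

  inPart : Fin n → Fin n → Bool
  inPart u w = eqF (cls w) (cls u)

  adjacent⇒different-parts : ∀ {u v} → H u v ≡ true → cls v ≢ cls u
  adjacent⇒different-parts {u} {v} adj same rewrite H-parts u v | same | eqF-refl (cls u) with () ← adj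

  nonadjacent⇒same-part : ∀ {u v} → H u v ≡ false → cls v ≡ cls u
  nonadjacent⇒same-part {u} {v} nonadj rewrite H-parts u v with cls v ≟ cls u
  ... | yes same = same
  nonadjacent⇒same-part () | no _

  common-neighbours : ∀ u v →
    count (λ w → H u w ∧ H v w) ≡ count (λ w → not (inPart u w) ∧ not (inPart v w))
  common-neighbours u v = count-ext (λ w → cong₂ _∧_ (H-parts u w) (H-parts v w))

  degree : ∀ u → count (H u) ≡ n ∸ r
  degree u = begin
    count (H u)              ≡⟨ count-ext (H-parts u) ⟩
    count (not ∘ inPart u)   ≡⟨ count-not (inPart u) ⟩
    n ∸ count (inPart u)     ≡⟨ cong (n ∸_) (part-size u) ⟩
    n ∸ r                    ∎
    where open ≡-Reasoning

  common-adjacent : ∀ u v → H u v ≡ true → count (λ w → H u w ∧ H v w) ≡ n ∸ 2 * r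
  common-adjacent u v adj = begin
    count (λ w → H u w ∧ H v w)
      ≡⟨ common-neighbours u v ⟩
    count (λ w → not (inPart u w) ∧ not (inPart v w))
      ≡⟨ count-ext (λ w → sym (not-∨ (inPart u w) _)) ⟩
    count (λ w → not (inPart u w ∨ inPart v w))
      ≡⟨ count-not (λ w → inPart u w ∨ inPart v w) ⟩
    n ∸ count (λ w → inPart u w ∨ inPart v w)
      ≡⟨ cong (n ∸_) (count-∨-disjoint disjoint) ⟩
    n ∸ (count (inPart u) + count (inPart v))
      ≡⟨ cong (n ∸_) (cong₂ _+_ (part-size u) (part-size v)) ⟩
    n ∸ (r + r)
      ≡⟨ cong (λ s → n ∸ (r + s)) (+-identityʳ r) ⟨
    n ∸ 2 * r ∎
    where
    open ≡-Reasoning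
    not-∨ : ∀ a b → not (a ∨ b) ≡ not a ∧ not b
    not-∨ true  _ = refl
    not-∨ false _ = refl
    disjoint : ∀ w → inPart u w ∧ inPart v w ≡ false
    disjoint w with cls w ≟ cls u | cls w ≟ cls v
    ... | yes wu | yes wv = contradiction (trans (sym wv) wu) (adjacent⇒different-parts adj)
    ... | yes _  | no _   = refl
    ... | no _   | _      = refl

  common-nonadjacent : ∀ u v → u ≢ v → H u v ≡ false → count (λ w → H u w ∧ H v w) ≡ n ∸ r
  common-nonadjacent u v _ nonadj = begin
    count (λ w → H u w ∧ H v w)
      ≡⟨ common-neighbours u v ⟩
    count (λ w → not (inPart u w) ∧ not (inPart v w))
      ≡⟨ count-ext (λ w → cong (λ c → not (inPart u w) ∧ not (eqF (cls w) c)) v~u) ⟩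
    count (λ w → not (inPart u w) ∧ not (inPart u w))
      ≡⟨ count-ext (λ w → ∧-idem (not (inPart u w))) ⟩
    count (λ w → not (inPart u w))
      ≡⟨ count-ext (λ w → sym (H-parts u w)) ⟩
    count (H u)
      ≡⟨ degree u ⟩
    n ∸ r ∎
    where
    open ≡-Reasoning
    v~u : cls v ≡ cls u
    v~u = nonadjacent⇒same-part nonadj

  stronglyRegular : StronglyRegular H (n ∸ r) (n ∸ 2 * r) (n ∸ r)
  stronglyRegular = degree , common-adjacent , common-nonadjacent

  indexInPart : Fin n → Fin r
  indexInPart u =
    fromℕ< (subst (rank (inPart u) u <_) (part-size u) (rank<count (inPart u) (eqF-refl (cls u))))

  cliqueCover : CliqueCover H r
  cliqueCover = indexInPart , covered
    where
    covered : ∀ x y → indexInPart x ≡ indexInPart y → (eqF x y ∨ H x y) ≡ true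
    covered x y same-index with cls x ≟ cls y
    ... | no different rewrite H-parts x y | ≢⇒eqF-false (different ∘ sym) = ∨-zeroʳ (eqF x y)
    ... | yes same = subst (λ z → (eqF x z ∨ H x z) ≡ true) x≡y (cong (_∨ H x x) (eqF-refl x))
      where
      same-rank : rank (inPart y) x ≡ rank (inPart y) y
      same-rank = begin
        rank (inPart y) x     ≡⟨ cong (λ c → rank (λ w → eqF (cls w) c) x) same ⟨
        rank (inPart x) x     ≡⟨ toℕ-fromℕ< _ ⟨
        toℕ (indexInPart x)   ≡⟨ cong toℕ same-index ⟩
        toℕ (indexInPart y)   ≡⟨ toℕ-fromℕ< _ ⟩
        rank (inPart y) y     ∎
        where open ≡-Reasoning
      x≡y : x ≡ y
      x≡y = rank-injective (inPart y) (subst (λ c → eqF (cls x) c ≡ true) same (eqF-refl (cls x)))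
                                      (eqF-refl (cls y)) same-rank

  part : Fin n → List (Fin n)
  part u = filter (λ w → cls w ≟ cls u) (allFin n)

  part-independent : ∀ u → Independent H (part u)
  part-independent u =
    AllPairs-restrict same-part⇒nonadjacent (all-filter (λ w → cls w ≟ cls u) (allFin n))
                                            (Uniqueₚ.filter⁺ (λ w → cls w ≟ cls u) (Uniqueₚ.allFin⁺ n))
    where
    same-part⇒nonadjacent : ∀ {x y} → cls x ≡ cls u → cls y ≡ cls u → x ≢ y → x ≢ y × H x y ≡ false
    same-part⇒nonadjacent {x} {y} xu yu x≢y rewrite H-parts x y | yu | xu | eqF-refl (cls u) = x≢y , refl

  length-part : ∀ u → length (part u) ≡ r
  length-part u = trans (sym (count≡length-filter (λ w → cls w ≟ cls u) (λ w → w))) (part-size u)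

  shannonCapacity : Fin n → ShannonCapacityIs H r
  shannonCapacity u =
    cliqueCover-independent⇒shannonCapacity cliqueCover (part u) (part-independent u) (length-part u)

isDist-at-diameter : ∀ {n} (E : BGraph (Fin n)) k u v → reach E (suc k) u v ≡ true →
                     isDist E u v (suc k) ≡ not (reach E k u v)
isDist-at-diameter E k u v within rewrite within = refl

reach-pred-diameter≡different-class :
  ∀ {n k} (E : BGraph (Fin n)) (d : ℕ) (cls : Fin n → Fin k) {u v} → u ≢ v →
  reach E d u v ≡ true →
  (cls u ≡ cls v → isDist E u v d ≡ true) × (isDist E u v d ≡ true → cls u ≡ cls v) →
  reach E (d ∸ 1) u v ≡ not (eqF (cls v) (cls u))
reach-pred-diameter≡different-class E zero cls u≢v within _ = contradiction (eqF⇒≡ within) u≢v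
reach-pred-diameter≡different-class E (suc k) cls {u} {v} _ within (same⇒antipodal , antipodal⇒same) =
  ≡-not-eqF (reach E k u v)
    (λ same → trans (sym (isDist-at-diameter E k u v within)) (same⇒antipodal (sym same)))
    (λ antipodal → sym (antipodal⇒same (trans (isDist-at-diameter E k u v within) antipodal)))

power-pred-diameter-isCompleteMultipartite :
  ∀ {n k} (E : BGraph (Fin n)) (d : ℕ) (cls : Fin n → Fin k) →
  (∀ u v → reach E d u v ≡ true) →
  (∀ u v → u ≢ v → (cls u ≡ cls v → isDist E u v d ≡ true) × (isDist E u v d ≡ true → cls u ≡ cls v)) →
  IsCompleteMultipartite (power E (d ∸ 1)) cls
power-pred-diameter-isCompleteMultipartite E d cls within antipodal u v with u ≟ v
... | yes refl rewrite eqF-refl (cls u) = refl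
... | no u≢v =
  reach-pred-diameter≡different-class E d cls u≢v (within u v) (antipodal u v u≢v)

proposition3p5 : {n : ℕ} (E : BGraph (Fin n)) (d r : ℕ) →
    IsSimple E → DistanceRegular E → HasDiameter E d → RAntipodal E d r →
    StronglyRegular (power E (d ∸ 1)) (n ∸ r) (n ∸ 2 * r) (n ∸ r)
    × ShannonCapacityIs (power E (d ∸ 1)) r
proposition3p5 E d r _ _ (within , u₀ , _) (cls , antipodal , class-size) =
  stronglyRegular , shannonCapacity u₀
  where
  open CompleteMultipartite (power-pred-diameter-isCompleteMultipartite E d cls within antipodal) class-size
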